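{- Let $H$ be an $r$-uniform hypergraph on $n$ vertices and $p$ an integer with $1\le p\le r-1$. Then $f(H,p,1)\ge \binom{n}{p}-b(H,p)$, and equality holds for $p=1$ and for $p=r-1$.
   Context: An orientation $D$ of $H$ assigns to each edge a linear ordering of its $r$ vertices (positions $1,\dots,r$). Let $P_1,\dots,P_{\binom rp}$ be the $p$-subsets of $\{1,\dots,r\}$. For a $p$-set $A\subseteq V(H)$, $d_i(A)$ is the number of edges $E\supseteq A$ in whose ordering the set of positions occupied by $A$ is exactly $P_i$. $f(D,p,k)$ is the number of $p$-sets $A$ with $d_i(A)\ge k$ for all $1\le i\le\binom rp$, and $f(H,p,k)$ is its minimum over all orientations $D$. An edge $E$ is $p$-monochromatic (under a coloring of $p$-sets) if all $p$-subsets of $E$ get the same color. $b(H,p)$ is the maximum size of a family $B$ of $p$-subsets of $V(H)$ that can be colored with at most $\binom rp$ colors so that no edge of $H$ all of whose $p$-subsets lie in $B$ is $p$-monochromatic. -}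

module Defs where

open import Data.Nat using (ℕ; zero; suc; _≤_; _≤?_)
open import Data.Nat.Properties using () renaming (_≟_ to _≟ℕ_)
open import Data.Bool using (Bool; true; false)
open import Data.Bool.Properties using () renaming (_≟_ to _≟B_)
open import Data.Fin using (Fin)
open import Data.Fin.Subset using (Subset; _⊆_; _∈_; ∣_∣)
open import Data.Fin.Subset.Properties using (_⊆?_)
open import Data.Vec using (Vec; []; _∷_; tabulate)
open import Data.Vec.Properties using (≡-dec)
open import Data.List using (List; []; _∷_; _++_; map; length; filter; lookup; allFin)
open import Data.List.Relation.Unary.All using (All)
open import Data.List.Relation.Unary.All using () renaming (all? to allL?)
open import Data.List.Relation.Unary.Unique.Propositional using (Unique)
open import Data.List.Membership.Propositional using () renaming (_∈_ to _∈L_)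
open import Data.Product using (Σ; _×_; _,_; ∃)
open import Relation.Nullary using (¬_; Dec; _×-dec_)
open import Relation.Nullary.Decidable using (_→-dec_)
open import Data.Nat.Combinatorics using (_C_)
open import Relation.Binary.PropositionalEquality using (_≡_)
open import Function.Definitions using (Injective)

allSubsets : (n : ℕ) → List (Subset n)
allSubsets zero    = [] ∷ []
allSubsets (suc n) = map (false ∷_) (allSubsets n) ++ map (true ∷_) (allSubsets n)

record Hypergraph (n r : ℕ) : Set where
  field
    edges   : List (Subset n)
    unique  : Unique edges
    uniform : All (λ E → ∣ E ∣ ≡ r) edges

open Hypergraph public

edge : ∀ {n r} (H : Hypergraph n r) → Fin (length (edges H)) → Subset n
edge H k = lookup (edges H) k

-- An orientation: each edge E gets a linear ordering of its r vertices,
-- i.e. a bijection  ord k : Fin r → E  (position j ↦ vertex in position j).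
record Orientation {n r : ℕ} (H : Hypergraph n r) : Set where
  field
    ord      : Fin (length (edges H)) → Fin r → Fin n
    ord-inj  : ∀ k → Injective _≡_ _≡_ (ord k)
    ord-onto : ∀ k (v : Fin n) → v ∈ edge H k → ∃ λ j → ord k j ≡ v
    ord-into : ∀ k (j : Fin r) → ord k j ∈ edge H k

open Orientation public

positions : ∀ {n r} {H : Hypergraph n r} → Orientation H →
            Fin (length (edges H)) → Subset n → Subset r
positions D k A = tabulate (λ j → Data.Vec.lookup A (ord D k j))

countFin : ∀ {m} → (P : Fin m → Set) → (∀ k → Dec (P k)) → ℕ
countFin {m} P P? = length (filter P? (allFin m))

deg : ∀ {n r} {H : Hypergraph n r} → Orientation H → Subset n → Subset r → ℕ
deg {H = H} D A P =
  countFin (λ k → (A ⊆ edge H k) × (positions D k A ≡ P))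
           (λ k → (A ⊆? edge H k) ×-dec ≡-dec _≟B_ (positions D k A) P)

fD : ∀ {n r} {H : Hypergraph n r} → Orientation H → ℕ → ℕ → ℕ
fD {n} {r} D p k =
  length (filter (λ A → (∣ A ∣ ≟ℕ p) ×-dec
                        allL? (λ P → (∣ P ∣ ≟ℕ p) →-dec (k ≤? deg D A P)) (allSubsets r))
                 (allSubsets n))

IsFH : ∀ {n r} → Hypergraph n r → ℕ → ℕ → ℕ → Set
IsFH H p k m = (Σ (Orientation H) λ D → fD D p k ≡ m) × (∀ (D : Orientation H) → m ≤ fD D p k)

_⊂ₚ_ : ∀ {n} → Subset n → Subset n → ℕ → Set
(A ⊂ₚ E) p = (∣ A ∣ ≡ p) × (A ⊆ E)

Admissible : ∀ {n r} → Hypergraph n r → (p : ℕ) → List (Subset n) → Set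
Admissible {n} {r} H p B =
  Unique B × All (λ A → ∣ A ∣ ≡ p) B ×
  Σ (Subset n → Fin (r C p)) λ c →
    ∀ E → E ∈L edges H →
      (∀ A → (A ⊂ₚ E) p → A ∈L B) →
      ¬ (∀ A A′ → (A ⊂ₚ E) p → (A′ ⊂ₚ E) p → c A ≡ c A′)

IsBH : ∀ {n r} → Hypergraph n r → ℕ → ℕ → Set
IsBH H p m = (Σ (List _) λ B → Admissible H p B × length B ≡ m)
           × (∀ B → Admissible H p B → length B ≤ m)

-- Fix an orientation D and call a p-set deficient if some position pattern P_i has d_i = 0; colour it
-- by such an i. An edge all of whose p-sets are deficient cannot be monochromatic, say of colour i:
-- the p-set occupying the positions P_i of that edge would have colour i, so d_i = 0, while that very
-- edge gives d_i ≥ 1. So the deficient p-sets form an admissible family, and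
-- f(D,p,1) = C(n,p) − #deficient ≥ C(n,p) − b(H,p).
--
-- Conversely, let B be admissible with colouring c. For p = 1 and p = r − 1 both the p-subsets of an
-- edge and the p-subsets of positions are indexed by Fin r, compatibly with reordering the edge. The
-- edge is reordered by a permutation π avoiding, in every row i whose p-set A_i lies in B, the single
-- column j whose position set is P_{c(A_i)}; such a π exists (induction on r, deleting one row and
-- one column) because no column is forbidden in every row, as the edge is not monochromatic inside B.
-- In the new orientation no member of B is counted by f, hence f(H,p,1) ≤ C(n,p) − |B|.

module Submission where

open import Defs

open import Data.Bool using (Bool; true; false; not)
open import Data.Bool.Properties using (not-involutive) renaming (_≟_ to _≟ᵇ_)
open import Data.Empty using (⊥-elim)
open import Data.Fin using (Fin; zero; suc; punchIn; punchOut; cast; fromℕ<)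
open import Data.Fin.Permutation using (Permutation; Permutation′; _⟨$⟩ʳ_; _⟨$⟩ˡ_; inverseˡ; inverseʳ; id; insert; insert-punchIn)
open import Data.Fin.Properties using (any?; all?; ¬∀⟶∃¬; cast-involutive; 0≢1+n; punchInᵢ≢i; punchIn-punchOut; punchIn-injective)
  renaming (_≟_ to _≟ᶠ_; suc-injective to fsuc-injective)
open import Data.Fin.Subset using (Subset; _∈_; _∉_; _⊆_; ∣_∣; _-_; ⁅_⁆; ∁; inside; outside)
open import Data.Fin.Subset.Properties using (_∈?_; _⊆?_; nonempty?; ⊆-antisym; Empty-unique; ∣⊥∣≡0; x∈⁅x⁆; x∈⁅y⁆⇒x≡y; ∣⁅x⁆∣≡1; p⊂q⇒∣p∣<∣q∣; ∣∁p∣≡n∸∣p∣; p─⊥≡p; p─q⊆p; x∈p∧x≢y⇒x∈p-y)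
open import Data.List as List using (List; []; _∷_; _++_; length; filter; allFin)
open import Data.List.Membership.Propositional using (find; lose) renaming (_∈_ to _∈ᴸ_)
open import Data.List.Membership.Propositional.Properties using (∈-filter⁺; ∈-filter⁻; ∈-map⁺; ∈-map⁻; ∈-++⁺ˡ; ∈-++⁺ʳ; ∈-++⁻; ∈-lookup; ∈-allFin)
open import Data.List.Properties using (filter-notAll; filter-some; filter-none; filter-≐; filter-++; length-++)
open import Data.List.Relation.Binary.Subset.Propositional using () renaming (_⊆_ to _⊆ᴸ_)
open import Data.List.Relation.Unary.All as All using (All; [])
open import Data.List.Relation.Unary.AllPairs using ([]; _∷_)
open import Data.List.Relation.Unary.Any as Any using (Any; here; there)
open import Data.List.Relation.Unary.Any.Properties using (lookup-index)
open import Data.List.Relation.Unary.Unique.Propositional using (Unique)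
import Data.List.Relation.Unary.Unique.Propositional.Properties as Unique
open import Data.Nat using (ℕ; zero; suc; _+_; _∸_; _≤_; _<_; _≤?_; z≤n; s≤s)
open import Data.Nat.Combinatorics using (_C_; nCk+nC[k+1]≡[n+1]C[k+1])
open import Data.Nat.Properties using (≤-trans; ≤-reflexive; ≤-antisym; <⇒≤; <⇒≱; <⇒≢; m≤m+n; +-comm; +-suc; suc-injective; 1+n≢0; n≢0⇒n>0; m∸[m∸n]≡n; m+n∸n≡m; ∸-monoˡ-≤; ∸-monoʳ-≤; module ≤-Reasoning)
  renaming (_≟_ to _≟ℕ_)
open import Data.Product using (∃; _×_; _,_; proj₁; proj₂)
open import Data.Sum using (_⊎_; inj₁; inj₂)
open import Data.Vec using ([]; _∷_; lookup; tabulate; here; there)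
open import Data.Vec.Properties using (∷-injectiveʳ; lookup∘tabulate; lookup-map; tabulate-∘; tabulate-cong; []=⇒lookup; lookup⇒[]=; ≡-dec)
open import Function using (_∘_)
open import Function.Definitions using (Injective)
open import Level using (0ℓ)
open import Relation.Binary.Definitions using (Decidable; DecidableEquality)
open import Relation.Binary.PropositionalEquality using (_≡_; _≢_; refl; sym; trans; cong; cong₂; subst; subst₂; module ≡-Reasoning)
open import Relation.Nullary using (¬_; Dec; yes; no; does; ¬?; _×-dec_)
open import Relation.Nullary.Decidable using (_→-dec_; dec-true; dec-yes)
open import Relation.Unary as U using (Pred)

module _ {A : Set} (_≟_ : DecidableEquality A) where

  Unique-⊆⇒length≤ : ∀ {xs ys : List A} → Unique xs → xs ⊆ᴸ ys → length xs ≤ length ys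
  Unique-⊆⇒length≤ {[]}     _            _    = z≤n
  Unique-⊆⇒length≤ {x ∷ xs} {ys} (x∉xs ∷ xs!) x∷xs⊆ys =
    ≤-trans (s≤s (Unique-⊆⇒length≤ xs! xs⊆ys-x)) (filter-notAll (λ y → ¬? (x ≟ y)) ys x∈ys)
    where
    xs⊆ys-x : xs ⊆ᴸ filter (λ y → ¬? (x ≟ y)) ys
    xs⊆ys-x y∈xs = ∈-filter⁺ (λ y → ¬? (x ≟ y)) (x∷xs⊆ys (there y∈xs)) (All.lookup x∉xs y∈xs)
    x∈ys : Any (λ y → ¬ x ≢ y) ys
    x∈ys = Any.map (λ x≡y x≢y → x≢y x≡y) (x∷xs⊆ys (here refl))

Unique-lookup-injective : ∀ {A : Set} {xs : List A} → Unique xs → ∀ i j → List.lookup xs i ≡ List.lookup xs j → i ≡ j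
Unique-lookup-injective (_ ∷ _)     zero    zero    _  = refl
Unique-lookup-injective (x∉xs ∷ _)  zero    (suc j) eq = ⊥-elim (All.lookup x∉xs (∈-lookup j) eq)
Unique-lookup-injective (x∉xs ∷ _)  (suc i) zero    eq = ⊥-elim (All.lookup x∉xs (∈-lookup i) (sym eq))
Unique-lookup-injective (_ ∷ xs!)   (suc i) (suc j) eq = cong suc (Unique-lookup-injective xs! i j eq)

module _ {A : Set} {P Q : Pred A 0ℓ} (P? : U.Decidable P) (Q? : U.Decidable Q) where

  length-filter-split : ∀ xs →
    length (filter (λ x → P? x ×-dec Q? x) xs) + length (filter (λ x → P? x ×-dec ¬? (Q? x)) xs)
      ≡ length (filter P? xs)
  length-filter-split []       = refl
  length-filter-split (x ∷ xs) with P? x | Q? x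
  ... | yes _ | yes _ = cong suc (length-filter-split xs)
  ... | yes _ | no  _ = trans (+-suc _ _) (cong suc (length-filter-split xs))
  ... | no  _ | _     = length-filter-split xs

length-filter-map : ∀ {A B : Set} {P : Pred B 0ℓ} (P? : U.Decidable P) (f : A → B) xs →
                    length (filter P? (List.map f xs)) ≡ length (filter (λ x → P? (f x)) xs)
length-filter-map P? f []       = refl
length-filter-map P? f (x ∷ xs) with does (P? (f x))
... | true  = cong suc (length-filter-map P? f xs)
... | false = length-filter-map P? f xs

0<length-filter⇒Any : ∀ {A : Set} {P : Pred A 0ℓ} (P? : U.Decidable P) xs → 0 < length (filter P? xs) → Any.Any P xs
0<length-filter⇒Any P? (x ∷ xs) 0<len with P? x
... | yes px = here px
... | no  _  = there (0<length-filter⇒Any P? xs 0<len)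

0<nCk : ∀ {n k} → k ≤ n → 0 < n C k
0<nCk {n}     {zero}  _         = s≤s z≤n
0<nCk {suc n} {suc k} (s≤s k≤n) = begin-strict
  0                  <⟨ 0<nCk k≤n ⟩
  n C k              ≤⟨ m≤m+n (n C k) (n C suc k) ⟩
  n C k + n C suc k  ≡⟨ nCk+nC[k+1]≡[n+1]C[k+1] n k ⟩
  suc n C suc k      ∎
  where open ≤-Reasoning

m+n≤o⇒m≤o∸n : ∀ {m n o} → m + n ≤ o → m ≤ o ∸ n
m+n≤o⇒m≤o∸n {m} {n} m+n≤o = subst (_≤ _) (m+n∸n≡m m n) (∸-monoˡ-≤ n m+n≤o)

m+n≡o∧n≤k⇒o∸k≤m : ∀ {m n o k} → m + n ≡ o → n ≤ k → o ∸ k ≤ m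
m+n≡o∧n≤k⇒o∸k≤m {m} {n} {o} {k} m+n≡o n≤k = begin
  o ∸ k      ≤⟨ ∸-monoʳ-≤ o n≤k ⟩
  o ∸ n      ≡⟨ cong (_∸ n) m+n≡o ⟨
  m + n ∸ n  ≡⟨ m+n∸n≡m m n ⟩
  m          ∎
  where open ≤-Reasoning

∈-allSubsets : ∀ {n} (A : Subset n) → A ∈ᴸ allSubsets n
∈-allSubsets []          = here refl
∈-allSubsets {suc n} (false ∷ A) = ∈-++⁺ˡ (∈-map⁺ (false ∷_) (∈-allSubsets A))
∈-allSubsets {suc n} (true ∷ A)  = ∈-++⁺ʳ (List.map (false ∷_) (allSubsets n)) (∈-map⁺ (true ∷_) (∈-allSubsets A))

allSubsets-unique : ∀ n → Unique (allSubsets n)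
allSubsets-unique zero    = [] ∷ []
allSubsets-unique (suc n) =
  Unique.++⁺ (Unique.map⁺ ∷-injectiveʳ (allSubsets-unique n)) (Unique.map⁺ ∷-injectiveʳ (allSubsets-unique n)) disjoint
  where
  disjoint : ∀ {A} → ¬ (A ∈ᴸ List.map (false ∷_) (allSubsets n) × A ∈ᴸ List.map (true ∷_) (allSubsets n))
  disjoint (A∈₀ , A∈₁) with ∈-map⁻ (false ∷_) A∈₀ | ∈-map⁻ (true ∷_) A∈₁
  ... | _ , _ , refl | _ , _ , ()

subsetsOfSize : ∀ n → ℕ → List (Subset n)
subsetsOfSize n p = filter (λ A → ∣ A ∣ ≟ℕ p) (allSubsets n)

length-subsetsOfSize : ∀ n p → length (subsetsOfSize n p) ≡ n C p
length-subsetsOfSize zero    zero    = refl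
length-subsetsOfSize zero    (suc p) = refl
length-subsetsOfSize (suc n) p       = begin
  length (filter (size≟ p) (List.map (false ∷_) S ++ List.map (true ∷_) S))
    ≡⟨ cong length (filter-++ (size≟ p) (List.map (false ∷_) S) (List.map (true ∷_) S)) ⟩
  length (filter (size≟ p) (List.map (false ∷_) S) ++ filter (size≟ p) (List.map (true ∷_) S))
    ≡⟨ length-++ (filter (size≟ p) (List.map (false ∷_) S)) ⟩
  length (filter (size≟ p) (List.map (false ∷_) S)) + length (filter (size≟ p) (List.map (true ∷_) S))
    ≡⟨ cong₂ _+_ (length-filter-map (size≟ p) (false ∷_) S) (length-filter-map (size≟ p) (true ∷_) S) ⟩
  length (subsetsOfSize n p) + length (filter (λ A → suc ∣ A ∣ ≟ℕ p) S)
    ≡⟨ pascal p ⟩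
  suc n C p ∎
  where
  open ≡-Reasoning
  S : List (Subset n)
  S = allSubsets n
  size≟ : ∀ {m} p (A : Subset m) → Dec (∣ A ∣ ≡ p)
  size≟ p A = ∣ A ∣ ≟ℕ p
  pascal : ∀ p → length (subsetsOfSize n p) + length (filter (λ A → suc ∣ A ∣ ≟ℕ p) S) ≡ suc n C p
  pascal zero    = cong₂ _+_ (length-subsetsOfSize n 0) (cong length (filter-none (λ A → suc ∣ A ∣ ≟ℕ 0) (All.universal (λ _ ()) S)))
  pascal (suc p) = begin
    length (subsetsOfSize n (suc p)) + length (filter (λ A → suc ∣ A ∣ ≟ℕ suc p) S)
      ≡⟨ cong (λ xs → length (subsetsOfSize n (suc p)) + length xs) (filter-≐ _ _ (suc-injective , cong suc) S) ⟩
    length (subsetsOfSize n (suc p)) + length (subsetsOfSize n p)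
      ≡⟨ cong₂ _+_ (length-subsetsOfSize n (suc p)) (length-subsetsOfSize n p) ⟩
    n C suc p + n C p
      ≡⟨ +-comm (n C suc p) (n C p) ⟩
    n C p + n C suc p
      ≡⟨ nCk+nC[k+1]≡[n+1]C[k+1] n p ⟩
    suc n C suc p ∎

does-true⇒ : ∀ {A : Set} (a? : Dec A) → does a? ≡ true → A
does-true⇒ (yes a) _ = a

∈-tabulate⁻ : ∀ {n} {f : Fin n → Bool} {v} → v ∈ tabulate f → f v ≡ true
∈-tabulate⁻ {f = f} {v} v∈ = trans (sym (lookup∘tabulate f v)) ([]=⇒lookup v∈)

∈-tabulate⁺ : ∀ {n} {f : Fin n → Bool} {v} → f v ≡ true → v ∈ tabulate f
∈-tabulate⁺ {f = f} {v} fv = lookup⇒[]= v (tabulate f) (trans (lookup∘tabulate f v) fv)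

x∉p-x : ∀ {n} {x : Fin n} {p : Subset n} → x ∉ p - x
x∉p-x {x = suc x} {_ ∷ p} (there x∈p-x) = x∉p-x x∈p-x

x∈p-y⇒x≢y : ∀ {n} {x y : Fin n} {p : Subset n} → x ∈ p - y → x ≢ y
x∈p-y⇒x≢y x∈p-y refl = x∉p-x x∈p-y

x∈p-y⇒x∈p : ∀ {n} {x y : Fin n} {p : Subset n} → x ∈ p - y → x ∈ p
x∈p-y⇒x∈p {y = y} {p} = p─q⊆p p ⁅ y ⁆

x∈p⇒∣p∣≡1+∣p-x∣ : ∀ {n} {x : Fin n} {p : Subset n} → x ∈ p → ∣ p ∣ ≡ suc ∣ p - x ∣
x∈p⇒∣p∣≡1+∣p-x∣ {x = zero}  {inside ∷ p}  here         = cong (suc ∘ ∣_∣) (sym (p─⊥≡p p))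
x∈p⇒∣p∣≡1+∣p-x∣ {x = suc x} {outside ∷ p} (there x∈p) = x∈p⇒∣p∣≡1+∣p-x∣ x∈p
x∈p⇒∣p∣≡1+∣p-x∣ {x = suc x} {inside ∷ p}  (there x∈p) = cong suc (x∈p⇒∣p∣≡1+∣p-x∣ x∈p)

module _ {r n : ℕ} (g : Fin r → Fin n) where

  preimage : Subset n → Subset r
  preimage A = tabulate (λ j → lookup A (g j))

  ∈-preimage⁻ : ∀ {A j} → j ∈ preimage A → g j ∈ A
  ∈-preimage⁻ {A} j∈ = lookup⇒[]= _ A (∈-tabulate⁻ j∈)

  ∈-preimage⁺ : ∀ {A j} → g j ∈ A → j ∈ preimage A
  ∈-preimage⁺ gj∈A = ∈-tabulate⁺ ([]=⇒lookup gj∈A)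

  image : Subset r → Subset n
  image Q = tabulate (λ v → does (any? λ j → (j ∈? Q) ×-dec (g j ≟ᶠ v)))

  ∈-image⁻ : ∀ {Q v} → v ∈ image Q → ∃ λ j → j ∈ Q × g j ≡ v
  ∈-image⁻ v∈ = does-true⇒ (any? _) (∈-tabulate⁻ v∈)

  ∈-image⁺ : ∀ {Q j} → j ∈ Q → g j ∈ image Q
  ∈-image⁺ {Q} {j} j∈Q = ∈-tabulate⁺ (dec-true (any? _) (j , j∈Q , refl))

Onto : ∀ {r n} → (Fin r → Fin n) → Subset n → Set
Onto g A = ∀ {v} → v ∈ A → ∃ λ j → g j ≡ v

Onto-suc : ∀ {r n} (g : Fin (suc r) → Fin n) {A} → Onto g A → g zero ∉ A → Onto (g ∘ suc) A
Onto-suc g onto g₀∉A v∈A with onto v∈A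
... | zero  , refl = ⊥-elim (g₀∉A v∈A)
... | suc j , gj≡v = j , gj≡v

preimage-∘ : ∀ {m r n} (g : Fin r → Fin n) (h : Fin m → Fin r) A →
             preimage (g ∘ h) A ≡ preimage h (preimage g A)
preimage-∘ g h A = tabulate-cong (λ j → sym (lookup∘tabulate (λ i → lookup A (g i)) (h j)))

preimage-- : ∀ {r n} (g : Fin r → Fin n) {A v} → (∀ j → g j ≢ v) → preimage g (A - v) ≡ preimage g A
preimage-- g {A} g≢v = ⊆-antisym (λ j∈ → ∈-preimage⁺ g (x∈p-y⇒x∈p {p = A} (∈-preimage⁻ g j∈)))
                                 (λ j∈ → ∈-preimage⁺ g (x∈p∧x≢y⇒x∈p-y {p = A} (∈-preimage⁻ g j∈) (g≢v _)))

∣preimage∣ : ∀ {r n} (g : Fin r → Fin n) → Injective _≡_ _≡_ g → ∀ {A} → Onto g A → ∣ preimage g A ∣ ≡ ∣ A ∣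
∣preimage∣ {zero} {n} g _ {A} onto = sym (trans (cong ∣_∣ (Empty-unique (λ (_ , v∈A) → noIndex (onto v∈A)))) (∣⊥∣≡0 n))
  where noIndex : ∀ {v} → ¬ ∃ λ (j : Fin 0) → g j ≡ v
        noIndex (() , _)
∣preimage∣ {suc r} {n} g g-inj {A} onto with lookup A (g zero) in g₀-in-A
... | true = begin
  suc ∣ preimage g′ A ∣             ≡⟨ cong (suc ∘ ∣_∣) (preimage-- g′ {A} (λ _ → 0≢1+n ∘ g-inj ∘ sym)) ⟨
  suc ∣ preimage g′ (A - g zero) ∣  ≡⟨ cong suc (∣preimage∣ g′ g′-inj (Onto-suc g (onto ∘ x∈p-y⇒x∈p {p = A}) (x∉p-x {p = A}))) ⟩
  suc ∣ A - g zero ∣                ≡⟨ x∈p⇒∣p∣≡1+∣p-x∣ (lookup⇒[]= _ A g₀-in-A) ⟨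
  ∣ A ∣                             ∎
  where
  open ≡-Reasoning
  g′ : Fin r → Fin n
  g′ = g ∘ suc
  g′-inj : Injective _≡_ _≡_ g′
  g′-inj = fsuc-injective ∘ g-inj
... | false = ∣preimage∣ (g ∘ suc) (fsuc-injective ∘ g-inj) (Onto-suc g onto g₀∉A)
  where
  g₀∉A : g zero ∉ A
  g₀∉A g₀∈A with () ← trans (sym ([]=⇒lookup g₀∈A)) g₀-in-A

module _ {r n : ℕ} {g : Fin r → Fin n} (g-inj : Injective _≡_ _≡_ g) where

  preimage-image : ∀ Q → preimage g (image g Q) ≡ Q
  preimage-image Q = ⊆-antisym sub (∈-preimage⁺ g ∘ ∈-image⁺ g)
    where
    sub : preimage g (image g Q) ⊆ Q
    sub j∈ with ∈-image⁻ g (∈-preimage⁻ g j∈)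
    ... | i , i∈Q , gi≡gj rewrite g-inj gi≡gj = i∈Q

  ∣image∣ : ∀ Q → ∣ image g Q ∣ ≡ ∣ Q ∣
  ∣image∣ Q = trans (sym (∣preimage∣ g g-inj onto)) (cong ∣_∣ (preimage-image Q))
    where
    onto : Onto g (image g Q)
    onto v∈ with ∈-image⁻ g v∈
    ... | j , _ , gj≡v = j , gj≡v

image-preimage : ∀ {r n} (g : Fin r → Fin n) {A} → Onto g A → image g (preimage g A) ≡ A
image-preimage g {A} onto = ⊆-antisym sub sup
  where
  sub : image g (preimage g A) ⊆ A
  sub v∈ with ∈-image⁻ g v∈
  ... | j , j∈ , refl = ∈-preimage⁻ g j∈
  sup : A ⊆ image g (preimage g A)
  sup v∈A with onto v∈A
  ... | j , refl = ∈-image⁺ g (∈-preimage⁺ g v∈A)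

image-⊆ : ∀ {r n} (g : Fin r → Fin n) {E} → (∀ j → g j ∈ E) → ∀ {Q} → image g Q ⊆ E
image-⊆ g g∈E v∈ with ∈-image⁻ g v∈
... | j , _ , refl = g∈E j

⊆∧∣⊇∣⇒≡ : ∀ {n} {p q : Subset n} → p ⊆ q → ∣ q ∣ ≤ ∣ p ∣ → p ≡ q
⊆∧∣⊇∣⇒≡ {p = p} {q} p⊆q ∣q∣≤∣p∣ with any? (λ x → (x ∈? q) ×-dec ¬? (x ∈? p))
... | yes (x , x∈q , x∉p) = ⊥-elim (<⇒≱ (p⊂q⇒∣p∣<∣q∣ (p⊆q , x , x∈q , x∉p)) ∣q∣≤∣p∣)
... | no  ∄x = ⊆-antisym p⊆q q⊆p
  where
  q⊆p : q ⊆ p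
  q⊆p {x} x∈q with x ∈? p
  ... | yes x∈p = x∈p
  ... | no  x∉p = ⊥-elim (∄x (x , x∈q , x∉p))

∣p∣≡1⇒p≡⁅x⁆ : ∀ {n} {p : Subset n} → ∣ p ∣ ≡ 1 → ∃ λ x → p ≡ ⁅ x ⁆
∣p∣≡1⇒p≡⁅x⁆ {n} {p} ∣p∣≡1 with nonempty? p
... | yes (x , x∈p) = x , sym (⊆∧∣⊇∣⇒≡ ⁅x⁆⊆p (≤-reflexive (trans ∣p∣≡1 (sym (∣⁅x⁆∣≡1 x)))))
  where
  ⁅x⁆⊆p : ⁅ x ⁆ ⊆ p
  ⁅x⁆⊆p y∈⁅x⁆ = subst (_∈ p) (sym (x∈⁅y⁆⇒x≡y x y∈⁅x⁆)) x∈p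
... | no  ∄x = ⊥-elim (1+n≢0 (trans (sym ∣p∣≡1) (trans (cong ∣_∣ (Empty-unique ∄x)) (∣⊥∣≡0 n))))

∁-involutive : ∀ {n} (p : Subset n) → ∁ (∁ p) ≡ p
∁-involutive []      = refl
∁-involutive (b ∷ p) = cong₂ _∷_ (not-involutive b) (∁-involutive p)

∁-injective : ∀ {n} → Injective _≡_ _≡_ (∁ {n})
∁-injective {x = p} {q} ∁p≡∁q = trans (sym (∁-involutive p)) (trans (cong ∁ ∁p≡∁q) (∁-involutive q))

preimage-∁ : ∀ {r n} (g : Fin r → Fin n) A → preimage g (∁ A) ≡ ∁ (preimage g A)
preimage-∁ g A = trans (tabulate-cong (λ j → lookup-map (g j) not A)) (tabulate-∘ not (λ j → lookup A (g j)))

-- Equivariant indexings of p-subsets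

-- τ lists all p-subsets of Fin r, one per position, compatibly with every permutation of the
-- positions. Such an indexing exists for p = 1 and p = r − 1; this is where the equality cases come from.
record EquivariantIndexing (r p : ℕ) : Set where
  field
    τ             : Fin r → Subset r
    τ-injective   : Injective _≡_ _≡_ τ
    τ-surjective  : ∀ Q → ∣ Q ∣ ≡ p → ∃ λ i → Q ≡ τ i
    τ-equivariant : ∀ (π : Permutation′ r) i → preimage (π ⟨$⟩ˡ_) (τ i) ≡ τ (π ⟨$⟩ʳ i)

singletonIndexing : ∀ r → EquivariantIndexing r 1
singletonIndexing r = record
  { τ             = ⁅_⁆
  ; τ-injective   = λ {i} ⁅i⁆≡⁅j⁆ → x∈⁅y⁆⇒x≡y _ (subst (i ∈_) ⁅i⁆≡⁅j⁆ (x∈⁅x⁆ i))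
  ; τ-surjective  = λ Q ∣Q∣≡1 → ∣p∣≡1⇒p≡⁅x⁆ ∣Q∣≡1
  ; τ-equivariant = λ π i → ⊆-antisym (sub π i) (sup π i)
  }
  where
  sub : ∀ (π : Permutation′ r) i → preimage (π ⟨$⟩ˡ_) ⁅ i ⁆ ⊆ ⁅ π ⟨$⟩ʳ i ⁆
  sub π i {j} j∈ with x∈⁅y⁆⇒x≡y i (∈-preimage⁻ (π ⟨$⟩ˡ_) j∈)
  ... | refl = subst (_∈ ⁅ π ⟨$⟩ʳ (π ⟨$⟩ˡ j) ⁆) (inverseʳ π) (x∈⁅x⁆ _)
  sup : ∀ (π : Permutation′ r) i → ⁅ π ⟨$⟩ʳ i ⁆ ⊆ preimage (π ⟨$⟩ˡ_) ⁅ i ⁆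
  sup π i j∈ with x∈⁅y⁆⇒x≡y _ j∈
  ... | refl = ∈-preimage⁺ (π ⟨$⟩ˡ_) (subst (_∈ ⁅ i ⁆) (sym (inverseˡ π)) (x∈⁅x⁆ i))

complementIndexing : ∀ {r p} → p ≤ r → EquivariantIndexing r p → EquivariantIndexing r (r ∸ p)
complementIndexing {r} {p} p≤r I = record
  { τ             = ∁ ∘ τ
  ; τ-injective   = τ-injective ∘ ∁-injective
  ; τ-surjective  = surjective
  ; τ-equivariant = λ π i → trans (preimage-∁ (π ⟨$⟩ˡ_) (τ i)) (cong ∁ (τ-equivariant π i))
  }
  where
  open EquivariantIndexing I
  surjective : ∀ Q → ∣ Q ∣ ≡ r ∸ p → ∃ λ i → Q ≡ ∁ (τ i)
  surjective Q ∣Q∣≡r∸p with τ-surjective (∁ Q) (trans (∣∁p∣≡n∸∣p∣ Q) (trans (cong (r ∸_) ∣Q∣≡r∸p) (m∸[m∸n]≡n p≤r)))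
  ... | i , ∁Q≡τi = i , trans (sym (∁-involutive Q)) (cong ∁ ∁Q≡τi)

-- Permutations avoiding forbidden entries

insert-self : ∀ {m n} i j (π : Permutation m n) → insert i j π ⟨$⟩ʳ i ≡ j
insert-self i j π rewrite proj₂ (dec-yes (i ≟ᶠ i) refl) = refl

module _ {r : ℕ} (Bad : Fin r → Fin r → Set) where

  Functional : Set
  Functional = ∀ {i j j′} → Bad i j → Bad i j′ → j ≡ j′

  NoBadColumn : Set
  NoBadColumn = ∀ j → ∃ λ i → ¬ Bad i j

  -- Row i₀ may be sent to column j₀, and once row i₀ and column j₀ are deleted, row i₁ has no bad entry.
  record Pivot : Set where
    field
      i₀ i₁ j₀  : Fin r
      i₀≢i₁     : i₀ ≢ i₁
      ¬Bad-i₀j₀ : ¬ Bad i₀ j₀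
      Bad-i₁⇒j₀ : ∀ {j} → Bad i₁ j → j ≡ j₀

module _ {m : ℕ} {Bad : Fin (suc m) → Fin (suc m) → Set} (Bad? : Decidable Bad) (functional : Functional Bad) where

  badColumn-bound : ∀ i → ∃ λ j₀ → ∀ {j} → Bad i j → j ≡ j₀
  badColumn-bound i with any? (Bad? i)
  ... | yes (j₀ , bad) = j₀ , λ bad′ → functional bad′ bad
  ... | no  ∄j         = zero , λ bad → ⊥-elim (∄j (_ , bad))

  everyRowBad⇒pivot : (∀ i → ∃ (Bad i)) → NoBadColumn Bad → Pivot Bad
  everyRowBad⇒pivot badColumn noBadColumn with badColumn zero
  ... | t , Bad₀t with noBadColumn t
  ... | i₁ , ¬Bad₁t with badColumn i₁
  ... | j₀ , Bad₁j₀ = record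
    { i₀ = zero ; i₁ = i₁ ; j₀ = j₀ ; i₀≢i₁ = λ 0≡i₁ → ¬Bad₁t (subst (λ i → Bad i t) 0≡i₁ Bad₀t)
    ; ¬Bad-i₀j₀ = λ Bad₀j₀ → ¬Bad₁t (subst (Bad i₁) (functional Bad₀j₀ Bad₀t) Bad₁j₀)
    ; Bad-i₁⇒j₀ = λ Bad₁j → functional Bad₁j Bad₁j₀ }

freeRow⇒pivot : ∀ {m} {Bad : Fin (suc (suc m)) → Fin (suc (suc m)) → Set} →
                Decidable Bad → Functional Bad → ∀ i₀ → (∀ j → ¬ Bad i₀ j) → Pivot Bad
freeRow⇒pivot Bad? functional i₀ i₀-free with badColumn-bound Bad? functional (punchIn i₀ zero)
... | j₀ , Bad-i₁⇒j₀ = record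
  { i₀ = i₀ ; i₁ = punchIn i₀ zero ; j₀ = j₀ ; i₀≢i₁ = punchInᵢ≢i i₀ zero ∘ sym
  ; ¬Bad-i₀j₀ = i₀-free j₀ ; Bad-i₁⇒j₀ = Bad-i₁⇒j₀ }

pivot : ∀ {m} {Bad : Fin (suc (suc m)) → Fin (suc (suc m)) → Set} →
        Decidable Bad → Functional Bad → NoBadColumn Bad → Pivot Bad
pivot {Bad = Bad} Bad? functional noBadColumn with any? (λ i → all? (λ j → ¬? (Bad? i j)))
... | yes (i₀ , i₀-free) = freeRow⇒pivot Bad? functional i₀ i₀-free
... | no  ∄free          = everyRowBad⇒pivot Bad? functional badColumn noBadColumn
  where
  badColumn : ∀ i → ∃ (Bad i)
  badColumn i with any? (Bad? i)
  ... | yes bad = bad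
  ... | no  ∄j  = ⊥-elim (∄free (i , λ j bad → ∄j (j , bad)))

AvoidingPermutation : ℕ → Set₁
AvoidingPermutation r = ∀ {Bad : Fin r → Fin r → Set} → Decidable Bad → Functional Bad → NoBadColumn Bad →
                        ∃ λ (π : Permutation′ r) → ∀ i → ¬ Bad i (π ⟨$⟩ʳ i)

avoidingPermutation-step : ∀ {m} → AvoidingPermutation (suc m) → AvoidingPermutation (suc (suc m))
avoidingPermutation-step {m} avoiding {Bad} Bad? functional noBadColumn = π , avoids
  where
  open Pivot (pivot Bad? functional noBadColumn)
  Bad′ : Fin (suc m) → Fin (suc m) → Set
  Bad′ i j = Bad (punchIn i₀ i) (punchIn j₀ j)
  noBadColumn′ : NoBadColumn Bad′
  noBadColumn′ t = punchOut i₀≢i₁ , λ bad →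
    punchInᵢ≢i j₀ t (Bad-i₁⇒j₀ (subst (λ i → Bad i (punchIn j₀ t)) (punchIn-punchOut i₀≢i₁) bad))
  reduced : ∃ λ (π′ : Permutation′ (suc m)) → ∀ i → ¬ Bad′ i (π′ ⟨$⟩ʳ i)
  reduced = avoiding {Bad′} (λ i j → Bad? _ _) (λ b b′ → punchIn-injective j₀ _ _ (functional b b′)) noBadColumn′
  π′ : Permutation′ (suc m)
  π′ = proj₁ reduced
  π : Permutation′ (suc (suc m))
  π = insert i₀ j₀ π′
  avoids : ∀ i → ¬ Bad i (π ⟨$⟩ʳ i)
  avoids i = split (i₀ ≟ᶠ i)
    where
    split : Dec (i₀ ≡ i) → ¬ Bad i (π ⟨$⟩ʳ i)
    split (yes refl) = subst (¬_ ∘ Bad i₀) (sym (insert-self i₀ j₀ π′)) ¬Bad-i₀j₀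
    split (no  i₀≢i) = subst (λ i → ¬ Bad i (π ⟨$⟩ʳ i)) (punchIn-punchOut i₀≢i)
                         (subst (¬_ ∘ Bad _) (sym (insert-punchIn i₀ j₀ π′ (punchOut i₀≢i))) (proj₂ reduced (punchOut i₀≢i)))

avoidingPermutation : ∀ r → AvoidingPermutation r
avoidingPermutation zero          _ _ _ = id , λ ()
avoidingPermutation (suc zero)    _ _ noBadColumn with noBadColumn zero
... | zero , ¬Bad₀₀ = id , λ { zero → ¬Bad₀₀ }
avoidingPermutation (suc (suc m)) = avoidingPermutation-step (avoidingPermutation (suc m))

-- Colours, degrees and the lower bound

module Colours (r p : ℕ) where

  -- Colour i stands for the p-set σ i of positions, the paper's P_i.
  σ : Fin (r C p) → Subset r
  σ i = List.lookup (subsetsOfSize r p) (cast (sym (length-subsetsOfSize r p)) i)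

  σ-size : ∀ i → ∣ σ i ∣ ≡ p
  σ-size i = proj₂ (∈-filter⁻ (λ P → ∣ P ∣ ≟ℕ p) {xs = allSubsets r} (∈-lookup _))

  σ-injective : Injective _≡_ _≡_ σ
  σ-injective {i} {j} σi≡σj = begin
    i                     ≡⟨ cast-involutive len (sym len) i ⟨
    cast len (cast _ i)   ≡⟨ cong (cast len) (Unique-lookup-injective (Unique.filter⁺ _ (allSubsets-unique r)) _ _ σi≡σj) ⟩
    cast len (cast _ j)   ≡⟨ cast-involutive len (sym len) j ⟩
    j                     ∎
    where
    open ≡-Reasoning
    len : length (subsetsOfSize r p) ≡ r C p
    len = length-subsetsOfSize r p

  colourOf : ∀ {P} → P ∈ᴸ subsetsOfSize r p → Fin (r C p)
  colourOf P∈ = cast (length-subsetsOfSize r p) (Any.index P∈)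

  σ-colourOf : ∀ {P} (P∈ : P ∈ᴸ subsetsOfSize r p) → σ (colourOf P∈) ≡ P
  σ-colourOf P∈ = trans (cong (List.lookup (subsetsOfSize r p)) (cast-involutive (sym len) len (Any.index P∈)))
                        (sym (lookup-index P∈))
    where
    len : length (subsetsOfSize r p) ≡ r C p
    len = length-subsetsOfSize r p

module _ {n r : ℕ} {H : Hypergraph n r} (D : Orientation H) where

  0<deg⁺ : ∀ {A P} k → A ⊆ edge H k → positions D k A ≡ P → 0 < deg D A P
  0<deg⁺ k A⊆E pos≡P = filter-some _ (lose (∈-allFin k) ((λ {_} → A⊆E) , pos≡P))

  0<deg⁻ : ∀ {A P} → 0 < deg D A P → ∃ λ k → A ⊆ edge H k × positions D k A ≡ P
  0<deg⁻ {A} {P} 0<deg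
    with find (0<length-filter⇒Any (λ k → (A ⊆? edge H k) ×-dec ≡-dec _≟ᵇ_ (positions D k A) P) (allFin _) 0<deg)
  ... | k , _ , A⊆E , pos≡P = k , A⊆E , pos≡P

  module _ (p : ℕ) where

    Full : Subset n → Set
    Full A = All (λ P → ∣ P ∣ ≡ p → 1 ≤ deg D A P) (allSubsets r)

    full? : ∀ A → Dec (Full A)
    full? A = All.all? (λ P → (∣ P ∣ ≟ℕ p) →-dec (1 ≤? deg D A P)) (allSubsets r)

    deficient : List (Subset n)
    deficient = filter (λ A → (∣ A ∣ ≟ℕ p) ×-dec ¬? (full? A)) (allSubsets n)

    fD+deficient≡nCp : fD D p 1 + length deficient ≡ n C p
    fD+deficient≡nCp = trans (length-filter-split (λ A → ∣ A ∣ ≟ℕ p) full? (allSubsets n)) (length-subsetsOfSize n p)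

    fD+nonFull≤nCp : ∀ {B} → Unique B → All (λ A → ∣ A ∣ ≡ p) B → (∀ {A} → A ∈ᴸ B → ¬ Full A) →
                     fD D p 1 + length B ≤ n C p
    fD+nonFull≤nCp {B} B-unique B-size B-nonFull =
      subst₂ _≤_ (length-++ full) (length-subsetsOfSize n p)
        (Unique-⊆⇒length≤ (≡-dec _≟ᵇ_) (Unique.++⁺ (Unique.filter⁺ _ (allSubsets-unique n)) B-unique disjoint) ⊆p-sets)
      where
      full : List (Subset n)
      full = filter (λ A → (∣ A ∣ ≟ℕ p) ×-dec full? A) (allSubsets n)
      disjoint : ∀ {A} → ¬ (A ∈ᴸ full × A ∈ᴸ B)
      disjoint (A∈full , A∈B) = B-nonFull A∈B (proj₂ (proj₂ (∈-filter⁻ _ {xs = allSubsets n} A∈full)))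
      ⊆p-sets : ∀ {A} → A ∈ᴸ full ++ B → A ∈ᴸ subsetsOfSize n p
      ⊆p-sets {A} A∈ with ∈-++⁻ full A∈
      ... | inj₁ A∈full = ∈-filter⁺ _ (∈-allSubsets A) (proj₁ (proj₂ (∈-filter⁻ _ {xs = allSubsets n} A∈full)))
      ... | inj₂ A∈B    = ∈-filter⁺ _ (∈-allSubsets A) (All.lookup B-size A∈B)

    module _ (p≤r : p ≤ r) where
      open Colours r p

      someColour : Fin (r C p)
      someColour = fromℕ< (0<nCk p≤r)

      colour : Subset n → Fin (r C p)
      colour A with Any.any? (λ P → deg D A P ≟ℕ 0) (subsetsOfSize r p)
      ... | yes deg≡0 = colourOf (proj₁ (proj₂ (find deg≡0)))
      ... | no  _     = someColour

      deg-colour≡0 : ∀ {A} → ¬ Full A → deg D A (σ (colour A)) ≡ 0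
      deg-colour≡0 {A} ¬full with Any.any? (λ P → deg D A P ≟ℕ 0) (subsetsOfSize r p)
      ... | yes deg≡0 = let (_ , P∈ , degP≡0) = find deg≡0 in trans (cong (deg D A) (σ-colourOf P∈)) degP≡0
      ... | no  ∄P    = ⊥-elim (¬full (All.tabulate λ P∈ ∣P∣≡p →
                          n≢0⇒n>0 (λ degP≡0 → ∄P (lose (∈-filter⁺ _ P∈ ∣P∣≡p) degP≡0))))

      NotMonochromaticIfDeficient : Subset n → Set
      NotMonochromaticIfDeficient E = (∀ A → (A ⊂ₚ E) p → A ∈ᴸ deficient) →
                                      ¬ (∀ A A′ → (A ⊂ₚ E) p → (A′ ⊂ₚ E) p → colour A ≡ colour A′)

      -- Some p-set A₀ of the edge fixes the common colour P₀; the p-set of the edge occupying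
      -- the positions P₀ then has colour P₀ although its P₀-degree is positive.
      notMonochromaticIfDeficient : ∀ k → NotMonochromaticIfDeficient (edge H k)
      notMonochromaticIfDeficient k allDeficient monochromatic =
        <⇒≢ (0<deg⁺ k (proj₂ A*⊂E) (preimage-image (ord-inj D k) P₀)) (sym deg*≡0)
        where
        image-p-set : ∀ i → (image (ord D k) (σ i) ⊂ₚ edge H k) p
        image-p-set i = trans (∣image∣ (ord-inj D k) (σ i)) (σ-size i) , image-⊆ (ord D k) (ord-into D k)
        A₀ : Subset n
        A₀ = image (ord D k) (σ someColour)
        P₀ : Subset r
        P₀ = σ (colour A₀)
        A* : Subset n
        A* = image (ord D k) P₀
        A*⊂E : (A* ⊂ₚ edge H k) p
        A*⊂E = image-p-set (colour A₀)
        deg*≡0 : deg D A* P₀ ≡ 0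
        deg*≡0 = trans (cong (deg D A* ∘ σ) (monochromatic _ _ (image-p-set someColour) A*⊂E))
                       (deg-colour≡0 (proj₂ (proj₂ (∈-filter⁻ _ {xs = allSubsets n} (allDeficient A* A*⊂E)))))

      deficient-admissible : Admissible H p deficient
      deficient-admissible =
          Unique.filter⁺ _ (allSubsets-unique n)
        , All.tabulate (λ A∈ → proj₁ (proj₂ (∈-filter⁻ _ {xs = allSubsets n} A∈)))
        , colour
        , λ E E∈ → subst NotMonochromaticIfDeficient (sym (lookup-index E∈)) (notMonochromaticIfDeficient (Any.index E∈))

-- Reorienting the edges

⟨$⟩ˡ-injective : ∀ {r} (π : Permutation′ r) → Injective _≡_ _≡_ (π ⟨$⟩ˡ_)
⟨$⟩ˡ-injective π {i} {j} eq = trans (sym (inverseʳ π)) (trans (cong (π ⟨$⟩ʳ_) eq) (inverseʳ π))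

reorient : ∀ {n r} {H : Hypergraph n r} → Orientation H → (Fin (length (edges H)) → Permutation′ r) → Orientation H
reorient D π = record
  { ord      = λ k → ord D k ∘ (π k ⟨$⟩ˡ_)
  ; ord-inj  = λ k → ⟨$⟩ˡ-injective (π k) ∘ ord-inj D k
  ; ord-onto = λ k v v∈E → let (j , ordj≡v) = ord-onto D k v v∈E in
                            π k ⟨$⟩ʳ j , trans (cong (ord D k) (inverseˡ (π k))) ordj≡v
  ; ord-into = λ k j → ord-into D k _
  }

positions-reorient : ∀ {n r} {H : Hypergraph n r} (D : Orientation H) π k A →
                     positions (reorient D π) k A ≡ preimage (π k ⟨$⟩ˡ_) (positions D k A)
positions-reorient D π k A = preimage-∘ (ord D k) (π k ⟨$⟩ˡ_) A

module Reorientation {n r p : ℕ} {H : Hypergraph n r} (I : EquivariantIndexing r p) (D : Orientation H)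
                     {B : List (Subset n)} (adm : Admissible H p B) where
  open EquivariantIndexing I
  open Colours r p

  c : Subset n → Fin (r C p)
  c = proj₁ (proj₂ (proj₂ adm))

  module _ (k : Fin (length (edges H))) where

    α : Fin r → Subset n
    α i = image (ord D k) (τ i)

    p-set⇒α : ∀ {A} → (A ⊂ₚ edge H k) p → ∃ λ i → A ≡ α i
    p-set⇒α {A} (∣A∣≡p , A⊆E) =
      let (i , posA≡τi) = τ-surjective (positions D k A) (trans (∣preimage∣ (ord D k) (ord-inj D k) onto) ∣A∣≡p)
      in  i , trans (sym (image-preimage (ord D k) onto)) (cong (image (ord D k)) posA≡τi)
      where
      onto : Onto (ord D k) A
      onto v∈A = ord-onto D k _ (A⊆E v∈A)

    Bad : Fin r → Fin r → Set
    Bad i j = α i ∈ᴸ B × τ j ≡ σ (c (α i))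

    Bad? : Decidable Bad
    Bad? i j = (α i ∈ᴸ? B) ×-dec ≡-dec _≟ᵇ_ (τ j) (σ (c (α i)))
      where open import Data.List.Membership.DecPropositional (≡-dec {n = n} _≟ᵇ_) using () renaming (_∈?_ to _∈ᴸ?_)

    functional : Functional Bad
    functional (_ , τj≡σ) (_ , τj′≡σ) = τ-injective (trans τj≡σ (sym τj′≡σ))

    -- A column that is bad in every row would make the edge a monochromatic edge inside B.
    noBadColumn : NoBadColumn Bad
    noBadColumn t = ¬∀⟶∃¬ r (λ i → Bad i t) (λ i → Bad? i t) λ allBad →
      proj₂ (proj₂ (proj₂ adm)) (edge H k) (∈-lookup k) (inB allBad) (monochromatic allBad)
      where
      inB : (∀ i → Bad i t) → ∀ A → (A ⊂ₚ edge H k) p → A ∈ᴸ B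
      inB allBad A A⊂E with p-set⇒α A⊂E
      ... | i , refl = proj₁ (allBad i)
      monochromatic : (∀ i → Bad i t) → ∀ A A′ → (A ⊂ₚ edge H k) p → (A′ ⊂ₚ edge H k) p → c A ≡ c A′
      monochromatic allBad A A′ A⊂E A′⊂E with p-set⇒α A⊂E | p-set⇒α A′⊂E
      ... | i , refl | i′ , refl = σ-injective (trans (sym (proj₂ (allBad i))) (proj₂ (allBad i′)))

    avoiding : ∃ λ (π : Permutation′ r) → ∀ i → ¬ Bad i (π ⟨$⟩ʳ i)
    avoiding = avoidingPermutation r Bad? functional noBadColumn

  π : Fin (length (edges H)) → Permutation′ r
  π k = proj₁ (avoiding k)

  D′ : Orientation H
  D′ = reorient D π

  positions-α : ∀ k i → positions D′ k (α k i) ≡ τ (π k ⟨$⟩ʳ i)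
  positions-α k i = trans (positions-reorient D π k (α k i))
                          (trans (cong (preimage (π k ⟨$⟩ˡ_)) (preimage-image (ord-inj D k) (τ i))) (τ-equivariant (π k) i))

  B-nonFull : ∀ {A} → A ∈ᴸ B → ¬ Full D′ p A
  B-nonFull {A} A∈B full with 0<deg⁻ D′ (All.lookup full (∈-allSubsets (σ (c A))) (σ-size (c A)))
  ... | k , A⊆E , posA≡σcA with p-set⇒α k (All.lookup (proj₁ (proj₂ adm)) A∈B , A⊆E)
  ... | i , refl = proj₂ (avoiding k) i (A∈B , trans (sym (positions-α k i)) posA≡σcA)

  fD′+B≤nCp : fD D′ p 1 + length B ≤ n C p
  fD′+B≤nCp = fD+nonFull≤nCp D′ p (proj₁ adm) (proj₁ (proj₂ adm)) B-nonFull

theorem11 : ∀ {n r : ℕ} (H : Hypergraph n r) (p : ℕ) → 1 ≤ p → p < r →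
            ∀ (f b : ℕ) → IsFH H p 1 f → IsBH H p b →
            (n C p) ∸ b ≤ f × ((p ≡ 1 ⊎ p ≡ r ∸ 1) → f ≡ (n C p) ∸ b)
theorem11 {n} {r} H p 1≤p p<r f b ((D , fD≡f) , f-minimal) ((B , B-admissible , ∣B∣≡b) , b-maximal) = lower , equality
  where
  lower : n C p ∸ b ≤ f
  lower = subst (n C p ∸ b ≤_) fD≡f
            (m+n≡o∧n≤k⇒o∸k≤m (fD+deficient≡nCp D p) (b-maximal _ (deficient-admissible D p (<⇒≤ p<r))))
  indexing : p ≡ 1 ⊎ p ≡ r ∸ 1 → EquivariantIndexing r p
  indexing (inj₁ p≡1)   = subst (EquivariantIndexing r) (sym p≡1) (singletonIndexing r)
  indexing (inj₂ p≡r∸1) = subst (EquivariantIndexing r) (sym p≡r∸1)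
                            (complementIndexing (≤-trans 1≤p (<⇒≤ p<r)) (singletonIndexing r))
  equality : p ≡ 1 ⊎ p ≡ r ∸ 1 → f ≡ n C p ∸ b
  equality shape = ≤-antisym (≤-trans (f-minimal D′) (subst (λ b → fD D′ p 1 ≤ n C p ∸ b) ∣B∣≡b (m+n≤o⇒m≤o∸n fD′+B≤nCp))) lower
    where open Reorientation (indexing shape) D B-admissible
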